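{- Define graphs $Q_1=K_1$ and $Q_t=(K_1\ast Q_{t-1})\uplus Q_{t-1}$ for $t\ge 2$, and let $\overline{Q}_s$ denote the complement of $Q_s$ (so $\overline{Q}_1=K_1$ and $\overline{Q}_s=(K_1\uplus\overline{Q}_{s-1})\ast\overline{Q}_{s-1}$). Then for every quasi-threshold graph $G$ there exists $t$ such that $G$ is isomorphic to an induced subgraph of $Q_t$, and for every complement $G$ of a quasi-threshold graph there exists $s$ such that $G$ is isomorphic to an induced subgraph of $\overline{Q}_s$.
   Context: $G\uplus H$ denotes the disjoint union of graphs $G$ and $H$; $G\ast H$ denotes their join, obtained from $G\uplus H$ by adding all edges between $V(G)$ and $V(H)$. A quasi-threshold graph is any graph obtainable from $K_1$ by repeatedly taking the join with $K_1$ and disjoint unions of quasi-threshold graphs (equivalently, the $\{P_4,C_4\}$-free graphs). -}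

module Defs where

open import Data.Nat using (ℕ; zero; suc; _+_)
open import Data.Fin using (Fin; splitAt)
open import Data.Bool using (Bool; true; false; not)
open import Data.Sum using (_⊎_; inj₁; inj₂)
open import Relation.Binary.PropositionalEquality using (_≡_; refl)
open import Function.Definitions using (Injective)
open import Function.Bundles using (_↔_; Inverse)

record Graph : Set where
  field
    n     : ℕ
    adj   : Fin n → Fin n → Bool
    sym   : ∀ u v → adj u v ≡ adj v u
    irrefl : ∀ v → adj v v ≡ false
open Graph public

K₁ : Graph
K₁ = record { n = 1 ; adj = λ _ _ → false ; sym = λ _ _ → refl ; irrefl = λ _ → refl }

private
  sumAdj : ∀ {m k} → (Fin m → Fin m → Bool) → (Fin k → Fin k → Bool) → Bool →
           Fin m ⊎ Fin k → Fin m ⊎ Fin k → Bool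
  sumAdj a b c (inj₁ x) (inj₁ y) = a x y
  sumAdj a b c (inj₂ x) (inj₂ y) = b x y
  sumAdj a b c (inj₁ x) (inj₂ y) = c
  sumAdj a b c (inj₂ x) (inj₁ y) = c

  sumSym : ∀ {m k} (a : Fin m → Fin m → Bool) (b : Fin k → Fin k → Bool) (c : Bool) →
           (∀ u v → a u v ≡ a v u) → (∀ u v → b u v ≡ b v u) →
           ∀ u v → sumAdj a b c u v ≡ sumAdj a b c v u
  sumSym a b c sa sb (inj₁ x) (inj₁ y) = sa x y
  sumSym a b c sa sb (inj₂ x) (inj₂ y) = sb x y
  sumSym a b c sa sb (inj₁ x) (inj₂ y) = refl
  sumSym a b c sa sb (inj₂ x) (inj₁ y) = refl

  sumIrr : ∀ {m k} (a : Fin m → Fin m → Bool) (b : Fin k → Fin k → Bool) (c : Bool) →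
           (∀ v → a v v ≡ false) → (∀ v → b v v ≡ false) →
           ∀ v → sumAdj a b c v v ≡ false
  sumIrr a b c ia ib (inj₁ x) = ia x
  sumIrr a b c ia ib (inj₂ x) = ib x

combine : Bool → Graph → Graph → Graph
combine c G H = record
  { n = n G + n H
  ; adj = λ u v → sumAdj (adj G) (adj H) c (splitAt (n G) u) (splitAt (n G) v)
  ; sym = λ u v → sumSym (adj G) (adj H) c (sym G) (sym H) (splitAt (n G) u) (splitAt (n G) v)
  ; irrefl = λ v → sumIrr (adj G) (adj H) c (irrefl G) (irrefl H) (splitAt (n G) v)
  }

_⊎ᴳ_ : Graph → Graph → Graph
G ⊎ᴳ H = combine false G H

_∗_ : Graph → Graph → Graph
G ∗ H = combine true G H

complement : Graph → Graph
complement G = record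
  { n = n G
  ; adj = λ u v → ∧' (not (adj G u v)) u v
  ; sym = λ u v → symC u v
  ; irrefl = λ v → irrC v
  }
  where
  open import Data.Fin using (_≟_)
  open import Relation.Nullary using (yes; no)
  ∧' : Bool → Fin (n G) → Fin (n G) → Bool
  ∧' b u v with u ≟ v
  ... | yes _ = false
  ... | no _ = b
  symC : ∀ u v → ∧' (not (adj G u v)) u v ≡ ∧' (not (adj G v u)) v u
  symC u v with u ≟ v | v ≟ u
  ... | yes _ | yes _ = refl
  ... | yes p | no q = Data.Empty.⊥-elim (q (Relation.Binary.PropositionalEquality.sym p))
    where import Data.Empty
  ... | no q | yes p = Data.Empty.⊥-elim (q (Relation.Binary.PropositionalEquality.sym p))
    where import Data.Empty
  ... | no _ | no _ rewrite Graph.sym G u v = refl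
  irrC : ∀ v → ∧' (not (adj G v v)) v v ≡ false
  irrC v with v ≟ v
  ... | yes _ = refl
  ... | no ¬p = Data.Empty.⊥-elim (¬p refl)
    where import Data.Empty

record _≅_ (G H : Graph) : Set where
  field
    bij : Fin (n G) ↔ Fin (n H)
    pres : ∀ u v → adj H (Inverse.to bij u) (Inverse.to bij v) ≡ adj G u v

record InducedSubgraphOf (G H : Graph) : Set where
  field
    f    : Fin (n G) → Fin (n H)
    inj  : Injective _≡_ _≡_ f
    pres : ∀ u v → adj H (f u) (f v) ≡ adj G u v

data QuasiThreshold : Graph → Set where
  qt-K₁    : QuasiThreshold K₁
  qt-join  : ∀ {G} → QuasiThreshold G → QuasiThreshold (K₁ ∗ G)
  qt-union : ∀ {G H} → QuasiThreshold G → QuasiThreshold H → QuasiThreshold (G ⊎ᴳ H)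
  qt-iso   : ∀ {G H} → QuasiThreshold G → G ≅ H → QuasiThreshold H

Q : ℕ → Graph
Q zero = K₁   -- unused convention; Q 0 := K₁ (paper starts at t = 1)
Q (suc zero) = K₁
Q (suc (suc t)) = (K₁ ∗ Q (suc t)) ⊎ᴳ Q (suc t)

-- Q̄_s is defined as the complement of Q_s (as in the paper; the recursion
-- Q̄_s = (K₁ ⊎ Q̄_{s-1}) ∗ Q̄_{s-1} is a consequence, up to isomorphism).
Qbar : ℕ → Graph
Qbar s = complement (Q s)

{-# OPTIONS --safe #-}
module Submission where

open import Defs
open import Data.Nat using (zero; suc; _+_; _≤_; _≥_; _≤′_; ≤′-refl; ≤′-step; _⊔_; s≤s; z≤n)
open import Data.Nat.Properties using (≤⇒≤′; m≤m⊔n; m≤n⊔m)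
open import Data.Product using (_×_; ∃-syntax; _,_)
open import Data.Fin using (Fin; splitAt; join; _↑ˡ_; _↑ʳ_; _≟_)
open import Data.Fin.Properties
  using (splitAt-↑ˡ; splitAt-↑ʳ; splitAt-join; join-splitAt; ↑ˡ-injective; ↑ʳ-injective)
open import Data.Bool using (true; false)
open import Data.Sum using (_⊎_; inj₁; inj₂) renaming (map to ⊎-map)
open import Data.Sum.Properties using (inj₁-injective; inj₂-injective)
open import Data.Empty using (⊥-elim)
open import Relation.Nullary using (yes; no)
open import Relation.Binary.PropositionalEquality
  using (_≡_; refl; trans; cong; cong₂; module ≡-Reasoning) renaming (sym to ≡-sym)
open import Function.Bundles using (Inverse; Injection)
open import Function.Properties.Inverse using (↔-sym; ↔⇒↣)

-- Q_{t+1} contains Q_t twice: as its right component and, below the apex, inside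
-- K₁ ∗ Q_t.  Hence K₁ ∗ G embeds once G embeds in Q_t, and G ⊎ H embeds once G and H
-- embed in a common Q_t (G into the left part, H into the right one).  Embeddings are
-- preserved by complementation, which gives the statement for complements.

infix 4 _⊑_

_⊑_ : Graph → Graph → Set
_⊑_ = InducedSubgraphOf

open InducedSubgraphOf

⊑-refl : ∀ {G} → G ⊑ G
⊑-refl = record { f = λ u → u ; inj = λ eq → eq ; pres = λ _ _ → refl }

⊑-trans : ∀ {G H K} → G ⊑ H → H ⊑ K → G ⊑ K
⊑-trans p q = record
  { f    = λ u → f q (f p u)
  ; inj  = λ eq → inj p (inj q eq)
  ; pres = λ u v → trans (pres q (f p u) (f p v)) (pres p u v)
  }

≅-sym : ∀ {G H} → G ≅ H → H ≅ G
≅-sym {G} {H} G≅H = record { bij = ↔-sym bij ; pres = pres-from }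
  where
  open _≅_ G≅H renaming (pres to pres-to)
  open Inverse bij using (from; strictlyInverseˡ)
  pres-from : ∀ u v → adj G (from u) (from v) ≡ adj H u v
  pres-from u v = trans (≡-sym (pres-to (from u) (from v)))
                        (cong₂ (adj H) (strictlyInverseˡ u) (strictlyInverseˡ v))

≅⇒⊑ : ∀ {G H} → G ≅ H → G ⊑ H
≅⇒⊑ G≅H = record
  { f    = Inverse.to bij
  ; inj  = Injection.injective (↔⇒↣ bij)
  ; pres = _≅_.pres G≅H
  }
  where open _≅_ G≅H using (bij)

⊑-combineˡ : ∀ c G H → G ⊑ combine c G H
⊑-combineˡ c G H = record
  { f    = _↑ˡ n H
  ; inj  = ↑ˡ-injective (n H) _ _
  ; pres = pres-↑ˡ
  }
  where
  pres-↑ˡ : ∀ u v → adj (combine c G H) (u ↑ˡ n H) (v ↑ˡ n H) ≡ adj G u v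
  pres-↑ˡ u v rewrite splitAt-↑ˡ (n G) u (n H) | splitAt-↑ˡ (n G) v (n H) = refl

⊑-combineʳ : ∀ c G H → H ⊑ combine c G H
⊑-combineʳ c G H = record
  { f    = n G ↑ʳ_
  ; inj  = ↑ʳ-injective (n G) _ _
  ; pres = pres-↑ʳ
  }
  where
  pres-↑ʳ : ∀ u v → adj (combine c G H) (n G ↑ʳ u) (n G ↑ʳ v) ≡ adj H u v
  pres-↑ʳ u v rewrite splitAt-↑ʳ (n G) (n H) u | splitAt-↑ʳ (n G) (n H) v = refl

combine-mono : ∀ c {G G′ H H′} → G ⊑ G′ → H ⊑ H′ → combine c G H ⊑ combine c G′ H′
combine-mono c {G} {G′} {H} {H′} p q = record { f = F ; inj = F-injective ; pres = F-pres }
  where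
  F : Fin (n G + n H) → Fin (n G′ + n H′)
  F u = join (n G′) (n H′) (⊎-map (f p) (f q) (splitAt (n G) u))

  splitAt-F : ∀ u → splitAt (n G′) (F u) ≡ ⊎-map (f p) (f q) (splitAt (n G) u)
  splitAt-F u = splitAt-join (n G′) (n H′) _

  map-injective : ∀ {x y} → ⊎-map (f p) (f q) x ≡ ⊎-map (f p) (f q) y → x ≡ y
  map-injective {inj₁ _} {inj₁ _} eq = cong inj₁ (inj p (inj₁-injective eq))
  map-injective {inj₂ _} {inj₂ _} eq = cong inj₂ (inj q (inj₂-injective eq))
  map-injective {inj₁ _} {inj₂ _} ()
  map-injective {inj₂ _} {inj₁ _} ()

  F-injective : ∀ {u v} → F u ≡ F v → u ≡ v
  F-injective {u} {v} Fu≡Fv = begin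
    u                                  ≡⟨ join-splitAt (n G) (n H) u ⟨
    join (n G) (n H) (splitAt (n G) u) ≡⟨ cong (join (n G) (n H)) (map-injective {x} {y} x↦≡y↦) ⟩
    join (n G) (n H) (splitAt (n G) v) ≡⟨ join-splitAt (n G) (n H) v ⟩
    v                                  ∎
    where
    open ≡-Reasoning
    x y : Fin (n G) ⊎ Fin (n H)
    x = splitAt (n G) u
    y = splitAt (n G) v
    x↦≡y↦ : ⊎-map (f p) (f q) x ≡ ⊎-map (f p) (f q) y
    x↦≡y↦ = trans (≡-sym (splitAt-F u)) (trans (cong (splitAt (n G′)) Fu≡Fv) (splitAt-F v))

  F-pres : ∀ u v → adj (combine c G′ H′) (F u) (F v) ≡ adj (combine c G H) u v
  F-pres u v rewrite splitAt-F u | splitAt-F v with splitAt (n G) u | splitAt (n G) v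
  ... | inj₁ x | inj₁ y = pres p x y
  ... | inj₁ _ | inj₂ _ = refl
  ... | inj₂ _ | inj₁ _ = refl
  ... | inj₂ x | inj₂ y = pres q x y

complement-mono : ∀ {G H} → G ⊑ H → complement G ⊑ complement H
complement-mono {G} {H} p = record { f = f p ; inj = inj p ; pres = pres-complement }
  where
  pres-complement : ∀ u v → adj (complement H) (f p u) (f p v) ≡ adj (complement G) u v
  pres-complement u v with f p u ≟ f p v | u ≟ v
  ... | yes _    | yes _  = refl
  ... | yes eq   | no u≢v = ⊥-elim (u≢v (inj p eq))
  ... | no fu≢fv | yes eq = ⊥-elim (fu≢fv (cong (f p) eq))
  ... | no _     | no _   rewrite pres p u v = refl

Q-step : ∀ t → Q t ⊑ Q (suc t)
Q-step zero    = ⊑-refl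
Q-step (suc t) = ⊑-combineʳ false (K₁ ∗ Q (suc t)) (Q (suc t))

Q-mono : ∀ {s t} → s ≤ t → Q s ⊑ Q t
Q-mono s≤t = go (≤⇒≤′ s≤t)
  where
  go : ∀ {s t} → s ≤′ t → Q s ⊑ Q t
  go ≤′-refl           = ⊑-refl
  go (≤′-step {t} s≤t) = ⊑-trans (go s≤t) (Q-step t)

quasiThreshold⇒⊑Q : ∀ {G} → QuasiThreshold G → ∃[ t ] G ⊑ Q (suc t)
quasiThreshold⇒⊑Q qt-K₁ = zero , ⊑-refl
quasiThreshold⇒⊑Q (qt-join qG) with quasiThreshold⇒⊑Q qG
... | t , G⊑Q = suc t , ⊑-trans (combine-mono true ⊑-refl G⊑Q)
                                 (⊑-combineˡ false (K₁ ∗ Q (suc t)) (Q (suc t)))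
quasiThreshold⇒⊑Q (qt-union {G} {H} qG qH) with quasiThreshold⇒⊑Q qG | quasiThreshold⇒⊑Q qH
... | a , G⊑Q | b , H⊑Q = suc (a ⊔ b) , combine-mono false G⊑K₁∗Q H⊑Q′
  where
  G⊑K₁∗Q : G ⊑ K₁ ∗ Q (suc (a ⊔ b))
  G⊑K₁∗Q = ⊑-trans (⊑-trans G⊑Q (Q-mono (s≤s (m≤m⊔n a b)))) (⊑-combineʳ true K₁ (Q (suc (a ⊔ b))))
  H⊑Q′ : H ⊑ Q (suc (a ⊔ b))
  H⊑Q′ = ⊑-trans H⊑Q (Q-mono (s≤s (m≤n⊔m a b)))
quasiThreshold⇒⊑Q (qt-iso qG G≅H) with quasiThreshold⇒⊑Q qG
... | t , G⊑Q = t , ⊑-trans (≅⇒⊑ (≅-sym G≅H)) G⊑Q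

mainTheorem2 : ((G : Graph) → QuasiThreshold G → ∃[ t ] (t ≥ 1 × InducedSubgraphOf G (Q t)))
    × ((G H : Graph) → QuasiThreshold H → G ≅ complement H → ∃[ s ] (s ≥ 1 × InducedSubgraphOf G (Qbar s)))
mainTheorem2 = embedQT , embedCoQT
  where
  embedQT : (G : Graph) → QuasiThreshold G → ∃[ t ] (t ≥ 1 × G ⊑ Q t)
  embedQT G qG with quasiThreshold⇒⊑Q qG
  ... | t , G⊑Q = suc t , s≤s z≤n , G⊑Q

  embedCoQT : (G H : Graph) → QuasiThreshold H → G ≅ complement H → ∃[ s ] (s ≥ 1 × G ⊑ Qbar s)
  embedCoQT G H qH G≅H̄ with quasiThreshold⇒⊑Q qH
  ... | s , H⊑Q = suc s , s≤s z≤n , ⊑-trans (≅⇒⊑ G≅H̄) (complement-mono H⊑Q)
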